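{- Let $a,b$ be positive integers with $b$ square-free. Suppose $f$ is a reduced primitive form of discriminant $-4a^2b$ that is derived from $e_{ -4b}=(1,0,b)\in C(-4b)$ and is not equivalent to $e_{ -4a^2b}=(1,0,a^2b)$. Then there exists a maximal $b_2=(a/a_2)^2b$, for some divisor $a_2$ of $a$, such that $f$ is derived from $e_{ -4b_2}=(1,0,b_2)\in C(-4b_2)$; and if $b_2>a_2^2$, then \[ f=(a_2^2,\,2a_2k,\,k^2+b_2) \] for some integer $k$ with $-a_2/2\le k\le a_2/2$.
   Context: A binary quadratic form $(a,b,c)$ is $ax^2+bxy+cy^2$ with integer coefficients, of discriminant $b^2-4ac$; primitive means $\gcd(a,b,c)=1$; equivalence is via substitutions $(x,y)^T\mapsto A(x,y)^T$ with $A\in SL_2(\mathbb{Z})$. A form $(a,b,c)$ of negative discriminant is reduced if $|b|\le a\le c$ and $b\ge0$ whenever $|b|=a$ or $a=c$. $C(\Delta)$ is the class group of primitive forms of discriminant $\Delta<0$. For a positive integer $r$, a primitive form of discriminant $\Delta r^2$ is derived from a form $g$ of discriminant $\Delta$ if it is equivalent to $g(A\cdot(x,y)^T)$ for some $2\times2$ integer matrix $A$ with $\det A=r$. -}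

module Defs where

open import Data.Nat as ℕ using (ℕ)
open import Data.Integer as ℤ using (ℤ; +_; _+_; _*_; -_; _-_; ∣_∣; _≤_)
open import Data.Integer.Divisibility using (_∣_)
import Data.Nat.Divisibility as ℕD
open import Data.Product using (Σ; ∃; _×_; _,_)
open import Data.Sum using (_⊎_)
open import Relation.Binary.PropositionalEquality using (_≡_)

-- A binary quadratic form a x² + b x y + c y² with integer coefficients.
record Form : Set where
  constructor form
  field
    a b c : ℤ
open Form public

disc : Form → ℤ
disc f = b f * b f - + 4 * a f * c f

Primitive : Form → Set
Primitive f = ∀ (d : ℤ) → d ∣ a f → d ∣ b f → d ∣ c f → ∣ d ∣ ≡ 1

Reduced : Form → Set
Reduced f = (+ ∣ b f ∣ ≤ a f) × (a f ≤ c f)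
          × ((+ ∣ b f ∣ ≡ a f ⊎ a f ≡ c f) → + 0 ≤ b f)

-- 2×2 integer matrix  [ p q ; u v ].
record Mat : Set where
  constructor mat
  field
    p q u v : ℤ
open Mat public

det : Mat → ℤ
det m = p m * v m - q m * u m

-- The form  g(A·(x,y)ᵀ) = g(p x + q y, u x + v y).
act : Form → Mat → Form
act g m = form
  (a g * p m * p m + b g * p m * u m + c g * u m * u m)
  (+ 2 * a g * p m * q m + b g * (p m * v m + q m * u m) + + 2 * c g * u m * v m)
  (a g * q m * q m + b g * q m * v m + c g * v m * v m)

Equivalent : Form → Form → Set
Equivalent f h = ∃ λ (M : Mat) → det M ≡ + 1 × act f M ≡ h

DerivedFrom : ℕ → Form → Form → Set
DerivedFrom r g f = Primitive f × (disc f ≡ disc g * (+ r * + r))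
                  × ∃ λ (A : Mat) → det A ≡ + r × Equivalent f (act g A)

e : ℕ → Form
e n = form (+ 1) (+ 0) (+ n)

SquareFree : ℕ → Set
SquareFree n = ∀ (d : ℕ) → (d ℕ.* d) ℕD.∣ n → d ≡ 1

-- If f is derived from some e_{-4n} with index d, then f represents d² at a nonzero vector:
-- the matrix A of the derivation sends its adjugate column (v, -u) to (det A, 0).
-- Conversely, if f represents P² primitively, completing (x, y) to a unimodular matrix turns f
-- into a form with leading coefficient P², and the discriminant -4P²N then forces it to be
-- (P², 2PQ, Q² + N) = e_{-4N} ∘ [[P, Q], [0, 1]], so f is derived from e_{-4N} with index P.
-- Let P be the least divisor of a such that f represents P²; this is decidable because a
-- positive definite form takes a given value at only finitely many points. A common factor
-- g > 1 of a representation of P² would yield the smaller divisor P/g, so the representation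
-- is primitive, and every index d ∣ a from which f is derived is at least P, which makes
-- b₂ = (a/P)² b maximal. When P² < b₂ the form (P², 2PQ, Q² + b₂) has minimum P², and so does
-- the reduced form f, whose minimum is its leading coefficient; hence a(f) = P², f itself is
-- (P², 2Pk, k² + b₂), and |b| ≤ a gives |2k| ≤ P.

{-# OPTIONS --safe #-}
module Submission where

open import Defs
open import Data.Nat as ℕ using (ℕ)
open import Data.Integer as ℤ using (ℤ; +_; _+_; _*_; -_; _≤_)
open import Data.Product using (Σ; ∃; _×_; _,_)
open import Relation.Binary.PropositionalEquality using (_≡_)
open import Relation.Nullary using (¬_)

open import Data.Empty using (⊥-elim)
open import Data.Integer using (_-_; ∣_∣; -[1+_]; +≤+; -≤+; -≤-)
open import Data.Integer.Coprimality using (Coprime)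
open import Data.Integer.Divisibility.Signed as ℤ∣ using (∣ᵤ⇒∣; ∣⇒∣ᵤ)
import Data.Integer.Properties as ℤₚ
open import Data.Integer.Tactic.RingSolver using (solve-∀)
open import Data.Nat using (zero; suc; s≤s; z≤n; z<s)
open import Data.Nat.Coprimality using (coprime-/gcd; coprime-divisor; coprime-Bézout)
open import Data.Nat.Divisibility as ℕ∣ using (divides)
open import Data.Nat.DivMod using (_/_; m/n*n≡m)
open import Data.Nat.GCD using (gcd; gcd[m,n]∣m; gcd[m,n]∣n; gcd[m,n]≡0⇒m≡0; gcd[m,n]≡0⇒n≡0; module Bézout)
open import Data.Nat.Induction using (<-rec)
import Data.Nat.Properties as ℕₚ
import Data.Nat.Tactic.RingSolver as ℕRing
open import Data.Product using (∃₂; proj₁; proj₂)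
import Data.Product.Properties as Σₚ
open import Data.Sum using (_⊎_; inj₁; inj₂)
open import Relation.Binary.PropositionalEquality using (_≢_; refl; sym; trans; cong; cong₂; subst; subst₂; module ≡-Reasoning)
open import Relation.Nullary using (Dec; yes; no)
open import Relation.Nullary.Decidable using (map′; ¬?; _×-dec_; _⊎-dec_)
open import Relation.Unary using (Decidable)

m*m∣n*n⇒m∣n : ∀ m n → m ℕ.* m ℕ∣.∣ n ℕ.* n → m ℕ∣.∣ n
m*m∣n*n⇒m∣n m n mm∣nn with gcd m n ℕₚ.≟ 0
... | yes g≡0 = subst₂ ℕ∣._∣_ (sym (gcd[m,n]≡0⇒m≡0 g≡0)) (sym (gcd[m,n]≡0⇒n≡0 m g≡0)) ℕ∣.∣-refl
... | no g≢0 = subst (ℕ∣._∣ n) g≡m (gcd[m,n]∣n m n)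
  where
  g = gcd m n
  instance
    g≢0′ : ℕ.NonZero g
    g≢0′ = ℕ.≢-nonZero g≢0
    gg≢0 : ℕ.NonZero (g ℕ.* g)
    gg≢0 = ℕₚ.m*n≢0 g g
  m′ = m / g
  n′ = n / g
  square-of-product : ∀ x y → (x ℕ.* y) ℕ.* (x ℕ.* y) ≡ (x ℕ.* x) ℕ.* (y ℕ.* y)
  square-of-product = ℕRing.solve-∀
  squared : ∀ k → g ℕ∣.∣ k → k ℕ.* k ≡ ((k / g) ℕ.* (k / g)) ℕ.* (g ℕ.* g)
  squared k g∣k = trans (sym (cong (λ t → t ℕ.* t) (m/n*n≡m g∣k))) (square-of-product (k / g) g)
  m′∣n′*n′ : m′ ℕ∣.∣ n′ ℕ.* n′
  m′∣n′*n′ = ℕ∣.m*n∣⇒m∣ m′ m′ (ℕ∣.*-cancelʳ-∣ (g ℕ.* g)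
    (subst₂ ℕ∣._∣_ (squared m (gcd[m,n]∣m m n)) (squared n (gcd[m,n]∣n m n)) mm∣nn))
  m′≡1 : m′ ≡ 1
  m′≡1 = coprime-/gcd m n (ℕ∣.∣-refl , coprime-divisor (coprime-/gcd m n) m′∣n′*n′)
  g≡m : g ≡ m
  g≡m = trans (sym (ℕₚ.*-identityˡ g)) (trans (cong (ℕ._* g) (sym m′≡1)) (m/n*n≡m (gcd[m,n]∣m m n)))

i*i∣j*j⇒i∣j : ∀ i j → i * i ℤ∣.∣ j * j → i ℤ∣.∣ j
i*i∣j*j⇒i∣j i j ii∣jj = ∣ᵤ⇒∣ (m*m∣n*n⇒m∣n ∣ i ∣ ∣ j ∣
  (subst₂ ℕ∣._∣_ (ℤₚ.abs-* i i) (ℤₚ.abs-* j j) (∣⇒∣ᵤ ii∣jj)))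

i*i≡∣i∣*∣i∣ : ∀ i → i * i ≡ + (∣ i ∣ ℕ.* ∣ i ∣)
i*i≡∣i∣*∣i∣ (+ n)    = sym (ℤₚ.pos-* n n)
i*i≡∣i∣*∣i∣ -[1+ n ] = refl

∣i∣≤n⇒-n≤i≤n : ∀ {i n} → ∣ i ∣ ℕ.≤ n → - (+ n) ≤ i × i ≤ + n
∣i∣≤n⇒-n≤i≤n {+ _}      m≤n       = ℤₚ.neg-≤-pos , +≤+ m≤n
∣i∣≤n⇒-n≤i≤n { -[1+ _ ]} (s≤s m≤n) = -≤- m≤n , -≤+

n≤n*n : ∀ n → n ℕ.≤ n ℕ.* n
n≤n*n zero        = z≤n
n≤n*n n@(suc _)   = ℕₚ.m≤m*n n n

m*n<m*m+n*n : ∀ m n → (m , n) ≢ (0 , 0) → m ℕ.* n ℕ.< m ℕ.* m ℕ.+ n ℕ.* n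
m*n<m*m+n*n zero    zero    mn≢0 = ⊥-elim (mn≢0 refl)
m*n<m*m+n*n zero    (suc n) _    = z<s
m*n<m*m+n*n (suc m) zero    _    =
  subst (ℕ._< suc m ℕ.* suc m ℕ.+ 0) (sym (ℕₚ.*-zeroʳ (suc m))) (ℕₚ.<-≤-trans z<s (ℕₚ.m≤m+n (suc m ℕ.* suc m) 0))
m*n<m*m+n*n m@(suc _) n@(suc _) _ with ℕₚ.≤-total m n
... | inj₁ m≤n = ℕₚ.≤-<-trans (ℕₚ.*-monoˡ-≤ n m≤n) (ℕₚ.m<n+m (n ℕ.* n) z<s)
... | inj₂ n≤m = ℕₚ.≤-<-trans (ℕₚ.*-monoʳ-≤ m n≤m) (ℕₚ.m<m+n (m ℕ.* m) z<s)

cross-term-dominated : ∀ {A B C α β} → B ℕ.≤ A → A ℕ.≤ C → (α , β) ≢ (0 , 0) →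
  A ℕ.+ B ℕ.* (α ℕ.* β) ℕ.≤ A ℕ.* (α ℕ.* α) ℕ.+ C ℕ.* (β ℕ.* β)
cross-term-dominated {A} {B} {C} {α} {β} B≤A A≤C αβ≢0 = begin
  A ℕ.+ B ℕ.* (α ℕ.* β)                ≤⟨ ℕₚ.+-monoʳ-≤ A (ℕₚ.*-monoˡ-≤ (α ℕ.* β) B≤A) ⟩
  A ℕ.+ A ℕ.* (α ℕ.* β)                ≡⟨ ℕₚ.*-suc A (α ℕ.* β) ⟨
  A ℕ.* suc (α ℕ.* β)                  ≤⟨ ℕₚ.*-monoʳ-≤ A (m*n<m*m+n*n α β αβ≢0) ⟩
  A ℕ.* (α ℕ.* α ℕ.+ β ℕ.* β)          ≡⟨ ℕₚ.*-distribˡ-+ A (α ℕ.* α) (β ℕ.* β) ⟩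
  A ℕ.* (α ℕ.* α) ℕ.+ A ℕ.* (β ℕ.* β)  ≤⟨ ℕₚ.+-monoʳ-≤ (A ℕ.* (α ℕ.* α)) (ℕₚ.*-monoˡ-≤ (β ℕ.* β) A≤C) ⟩
  A ℕ.* (α ℕ.* α) ℕ.+ C ℕ.* (β ℕ.* β)  ∎
  where open ℕₚ.≤-Reasoning

sum-of-squares-bound : ∀ {k D} .{{_ : ℕ.NonZero D}} z w → + k ≡ z * z + + D * (w * w) → ∣ w ∣ ℕ.≤ k
sum-of-squares-bound {k} {D} z w k≡ = begin
  ∣ w ∣                                   ≤⟨ n≤n*n ∣ w ∣ ⟩
  ∣ w ∣ ℕ.* ∣ w ∣                         ≤⟨ ℕₚ.m≤n*m _ D ⟩
  D ℕ.* (∣ w ∣ ℕ.* ∣ w ∣)                 ≤⟨ ℕₚ.m≤n+m _ (∣ z ∣ ℕ.* ∣ z ∣) ⟩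
  ∣ z ∣ ℕ.* ∣ z ∣ ℕ.+ D ℕ.* (∣ w ∣ ℕ.* ∣ w ∣) ≡⟨ ℤₚ.+-injective k≡′ ⟨
  k                                       ∎
  where
  open ℕₚ.≤-Reasoning
  k≡′ : + k ≡ + (∣ z ∣ ℕ.* ∣ z ∣ ℕ.+ D ℕ.* (∣ w ∣ ℕ.* ∣ w ∣))
  k≡′ = trans k≡ (trans (cong₂ (λ s t → s + + D * t) (i*i≡∣i∣*∣i∣ z) (i*i≡∣i∣*∣i∣ w))
          (trans (cong (λ t → + (∣ z ∣ ℕ.* ∣ z ∣) + t) (sym (ℤₚ.pos-* D (∣ w ∣ ℕ.* ∣ w ∣))))
            (sym (ℤₚ.pos-+ (∣ z ∣ ℕ.* ∣ z ∣) (D ℕ.* (∣ w ∣ ℕ.* ∣ w ∣))))))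

divisor-nonZero : ∀ {d n} .{{_ : ℕ.NonZero n}} → d ℕ∣.∣ n → ℕ.NonZero d
divisor-nonZero {zero} {n} 0∣n = ⊥-elim (ℕ.≢-nonZero⁻¹ n (ℕ∣.0∣⇒≡0 0∣n))
divisor-nonZero {suc _}    _   = _

abs-as-multiple : ∀ i → ∃ λ σ → σ * i ≡ + ∣ i ∣
abs-as-multiple (+ n)    = + 1 , ℤₚ.*-identityˡ (+ n)
abs-as-multiple -[1+ n ] = - + 1 , ℤₚ.-1*i≡-i -[1+ n ]

bezout-from-ℕ : ∀ x y u w → 1 ℕ.+ w ℕ.* ∣ y ∣ ≡ u ℕ.* ∣ x ∣ → ∃₂ λ r s → r * x + s * y ≡ + 1
bezout-from-ℕ x y u w 1+w∣y∣≡u∣x∣ with abs-as-multiple x | abs-as-multiple y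
... | σ , σx≡∣x∣ | τ , τy≡∣y∣ = + u * σ , - (+ w * τ) , (begin
  + u * σ * x + - (+ w * τ) * y         ≡⟨ regroup (+ u) σ x (+ w) τ y ⟩
  + u * (σ * x) - + w * (τ * y)         ≡⟨ cong₂ (λ s t → + u * s - + w * t) σx≡∣x∣ τy≡∣y∣ ⟩
  + u * + ∣ x ∣ - + w * + ∣ y ∣         ≡⟨ cong₂ _-_ (ℤₚ.pos-* u ∣ x ∣) (ℤₚ.pos-* w ∣ y ∣) ⟨
  + (u ℕ.* ∣ x ∣) - + (w ℕ.* ∣ y ∣)     ≡⟨ cong (λ t → + t - + (w ℕ.* ∣ y ∣)) 1+w∣y∣≡u∣x∣ ⟨
  + (1 ℕ.+ w ℕ.* ∣ y ∣) - + (w ℕ.* ∣ y ∣) ≡⟨ cong (_- + (w ℕ.* ∣ y ∣)) (ℤₚ.pos-+ 1 (w ℕ.* ∣ y ∣)) ⟩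
  + 1 + + (w ℕ.* ∣ y ∣) - + (w ℕ.* ∣ y ∣) ≡⟨ cancel (+ 1) (+ (w ℕ.* ∣ y ∣)) ⟩
  + 1                                   ∎)
  where
  open ≡-Reasoning
  regroup : ∀ u σ x w τ y → u * σ * x + - (w * τ) * y ≡ u * (σ * x) - w * (τ * y)
  regroup = solve-∀
  cancel : ∀ s t → s + t - t ≡ s
  cancel = solve-∀

coprime⇒bezout : ∀ x y → Coprime x y → ∃₂ λ r s → r * x + s * y ≡ + 1
coprime⇒bezout x y coprime with coprime-Bézout coprime
... | Bézout.+- u w eq = bezout-from-ℕ x y u w eq
... | Bézout.-+ u w eq with bezout-from-ℕ y x w u eq
...   | s , r , sy+rx≡1 = r , s , trans (ℤₚ.+-comm (r * x) (s * y)) sy+rx≡1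

least : ∀ {ℓ} {P : ℕ → Set ℓ} → Decidable P → ∀ {k} → P k → ∃ λ m → P m × (∀ {j} → j ℕ.< m → ¬ P j)
least {ℓ} {P} P? {k} = <-rec (λ k → P k → Least) step k
  where
  Least : Set ℓ
  Least = ∃ λ m → P m × (∀ {j} → j ℕ.< m → ¬ P j)
  step : ∀ k → (∀ {j} → j ℕ.< k → P j → Least) → P k → Least
  step k smaller Pk with ℕₚ.anyUpTo? P? k
  ... | yes (j , j<k , Pj) = smaller j<k Pj
  ... | no none-below      = k , Pk , λ j<k Pj → none-below (_ , j<k , Pj)

any-∣∣<? : ∀ {ℓ} {P : ℤ → Set ℓ} → Decidable P → ∀ K → Dec (∃ λ x → ∣ x ∣ ℕ.< K × P x)
any-∣∣<? {P = P} P? K = map′ from-ℕ to-ℕ (ℕₚ.anyUpTo? (λ n → P? (+ n) ⊎-dec P? (- + n)) K)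
  where
  from-ℕ : (∃ λ n → n ℕ.< K × (P (+ n) ⊎ P (- + n))) → ∃ λ x → ∣ x ∣ ℕ.< K × P x
  from-ℕ (n , n<K , inj₁ P+n) = + n , n<K , P+n
  from-ℕ (n , n<K , inj₂ P-n) = - + n , subst (ℕ._< K) (sym (ℤₚ.∣-i∣≡∣i∣ (+ n))) n<K , P-n
  to-ℕ : (∃ λ x → ∣ x ∣ ℕ.< K × P x) → ∃ λ n → n ℕ.< K × (P (+ n) ⊎ P (- + n))
  to-ℕ (+ n      , n<K , Px) = n , n<K , inj₁ Px
  to-ℕ (-[1+ n ] , n<K , Px) = suc n , n<K , inj₂ Px

eval : Form → ℤ → ℤ → ℤ
eval f x y = a f * x * x + b f * x * y + c f * y * y

Represents : Form → ℤ → Set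
Represents f m = ∃₂ λ x y → (x , y) ≢ (+ 0 , + 0) × eval f x y ≡ m

ProperlyRepresents : Form → ℤ → Set
ProperlyRepresents f m = ∃₂ λ x y → Coprime x y × eval f x y ≡ m

principal : ℕ → ℤ → ℤ → Form
principal P Q N = form (+ (P ℕ.* P)) (+ 2 * + P * Q) (Q * Q + N)

swap : Form → Form
swap f = form (c f) (b f) (a f)

form-cong : ∀ {A A′ B B′ C C′} → A ≡ A′ → B ≡ B′ → C ≡ C′ → form A B C ≡ form A′ B′ C′
form-cong refl refl refl = refl

eval-act : ∀ f M x y → eval (act f M) x y ≡ eval f (p M * x + q M * y) (u M * x + v M * y)
eval-act (form A B C) (mat α β γ δ) x y = identity A B C α β γ δ x y
  where
  identity : ∀ A B C α β γ δ x y →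
    (A * α * α + B * α * γ + C * γ * γ) * x * x
      + (+ 2 * A * α * β + B * (α * δ + β * γ) + + 2 * C * γ * δ) * x * y
      + (A * β * β + B * β * δ + C * δ * δ) * y * y
    ≡ A * (α * x + β * y) * (α * x + β * y) + B * (α * x + β * y) * (γ * x + δ * y)
      + C * (γ * x + δ * y) * (γ * x + δ * y)
  identity = solve-∀

disc-act : ∀ f M → disc (act f M) ≡ disc f * (det M * det M)
disc-act (form A B C) (mat α β γ δ) = identity A B C α β γ δ
  where
  identity : ∀ A B C α β γ δ →
    (+ 2 * A * α * β + B * (α * δ + β * γ) + + 2 * C * γ * δ)
      * (+ 2 * A * α * β + B * (α * δ + β * γ) + + 2 * C * γ * δ)
      - + 4 * (A * α * α + B * α * γ + C * γ * γ) * (A * β * β + B * β * δ + C * δ * δ)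
    ≡ (B * B - + 4 * A * C) * ((α * δ - β * γ) * (α * δ - β * γ))
  identity = solve-∀

eval-scale : ∀ f x y g → eval f (x * g) (y * g) ≡ (g * g) * eval f x y
eval-scale (form A B C) = identity A B C
  where
  identity : ∀ A B C x y g → A * (x * g) * (x * g) + B * (x * g) * (y * g) + C * (y * g) * (y * g)
                           ≡ (g * g) * (A * x * x + B * x * y + C * y * y)
  identity = solve-∀

eval-on-axis : ∀ f x → eval f x (+ 0) ≡ a f * (x * x)
eval-on-axis (form A B C) = identity A B C
  where
  identity : ∀ A B C x → A * x * x + B * x * + 0 + C * + 0 * + 0 ≡ A * (x * x)
  identity = solve-∀

eval-swap : ∀ f x y → eval (swap f) y x ≡ eval f x y
eval-swap (form A B C) = identity A B C
  where
  identity : ∀ A B C x y → C * y * y + B * y * x + A * x * x ≡ A * x * x + B * x * y + C * y * y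
  identity = solve-∀

disc-swap : ∀ f → disc (swap f) ≡ disc f
disc-swap (form A B C) = identity A B C
  where
  identity : ∀ A B C → B * B - + 4 * C * A ≡ B * B - + 4 * A * C
  identity = solve-∀

eval-principal : ∀ P Q N z w →
  eval (principal P Q N) z w ≡ (+ P * z + Q * w) * (+ P * z + Q * w) + N * (w * w)
eval-principal P Q N z w =
  trans (cong (λ s → s * z * z + + 2 * + P * Q * z * w + (Q * Q + N) * w * w) (ℤₚ.pos-* P P))
        (identity (+ P) Q N z w)
  where
  identity : ∀ P Q N z w → (P * P) * z * z + + 2 * P * Q * z * w + (Q * Q + N) * w * w
                         ≡ (P * z + Q * w) * (P * z + Q * w) + N * (w * w)
  identity = solve-∀

disc-principal : ∀ P Q N → disc (principal P Q N) ≡ - (+ 4 * + (P ℕ.* P) * N)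
disc-principal P Q N = identity (+ (P ℕ.* P)) (+ P) Q N (ℤₚ.pos-* P P)
  where
  expand : ∀ P Q N → (+ 2 * P * Q) * (+ 2 * P * Q) - + 4 * (P * P) * (Q * Q + N) ≡ - (+ 4 * (P * P) * N)
  expand = solve-∀
  identity : ∀ X P Q N → X ≡ P * P →
    (+ 2 * P * Q) * (+ 2 * P * Q) - + 4 * X * (Q * Q + N) ≡ - (+ 4 * X * N)
  identity _ P Q N refl = expand P Q N

act-e-upper-triangular : ∀ P Q n → act (e n) (mat (+ P) Q (+ 0) (+ 1)) ≡ principal P Q (+ n)
act-e-upper-triangular P Q n = form-cong
  (trans (leading (+ P) (+ n)) (sym (ℤₚ.pos-* P P))) (middle (+ P) Q (+ n)) (last Q (+ n))
  where
  leading : ∀ P n → + 1 * P * P + + 0 * P * + 0 + n * + 0 * + 0 ≡ P * P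
  leading = solve-∀
  middle : ∀ P Q n → + 2 * + 1 * P * Q + + 0 * (P * + 1 + Q * + 0) + + 2 * n * + 0 * + 1 ≡ + 2 * P * Q
  middle = solve-∀
  last : ∀ Q n → + 1 * Q * Q + + 0 * Q * + 1 + n * + 1 * + 1 ≡ Q * Q + n
  last = solve-∀

eval-adjugate-column : ∀ f M → eval (act f M) (v M) (- u M) ≡ a f * (det M * det M)
eval-adjugate-column f M@(mat α β γ δ) = begin
  eval (act f M) δ (- γ)                                  ≡⟨ eval-act f M δ (- γ) ⟩
  eval f (α * δ + β * (- γ)) (γ * δ + δ * (- γ))          ≡⟨ cong₂ (eval f) (first α β γ δ) (second γ δ) ⟩
  eval f (det M) (+ 0)                                    ≡⟨ eval-on-axis f (det M) ⟩
  a f * (det M * det M)                                   ∎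
  where
  open ≡-Reasoning
  first : ∀ α β γ δ → α * δ + β * (- γ) ≡ α * δ - β * γ
  first = solve-∀
  second : ∀ γ δ → γ * δ + δ * (- γ) ≡ + 0
  second = solve-∀

adjugate-column-nonzero : ∀ M → det M ≢ + 0 → (v M , - u M) ≢ (+ 0 , + 0)
adjugate-column-nonzero (mat α β γ δ) det≢0 eq = det≢0 (begin
  α * δ - β * γ       ≡⟨ cong₂ (λ s t → α * s - β * t) (cong proj₁ eq) γ≡0 ⟩
  α * + 0 - β * + 0   ≡⟨ vanish α β ⟩
  + 0                 ∎)
  where
  open ≡-Reasoning
  γ≡0 : γ ≡ + 0
  γ≡0 = trans (sym (ℤₚ.neg-involutive γ)) (cong -_ (cong proj₂ eq))
  vanish : ∀ α β → α * + 0 - β * + 0 ≡ + 0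
  vanish = solve-∀

unimodular-kernel : ∀ M {z w} → det M ≡ + 1 →
  p M * z + q M * w ≡ + 0 → u M * z + v M * w ≡ + 0 → (z , w) ≡ (+ 0 , + 0)
unimodular-kernel (mat α β γ δ) {z} {w} det≡1 first≡0 second≡0 = cong₂ _,_
  (begin
    z                                                 ≡⟨ unit z ⟨
    + 1 * z                                           ≡⟨ cong (_* z) det≡1 ⟨
    (α * δ - β * γ) * z                               ≡⟨ solve-z α β γ δ z w ⟩
    δ * (α * z + β * w) - β * (γ * z + δ * w)         ≡⟨ cong₂ (λ s t → δ * s - β * t) first≡0 second≡0 ⟩
    δ * + 0 - β * + 0                                 ≡⟨ vanish δ β ⟩
    + 0                                               ∎)
  (begin
    w                                                 ≡⟨ unit w ⟨
    + 1 * w                                           ≡⟨ cong (_* w) det≡1 ⟨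
    (α * δ - β * γ) * w                               ≡⟨ solve-w α β γ δ z w ⟩
    α * (γ * z + δ * w) - γ * (α * z + β * w)         ≡⟨ cong₂ (λ s t → α * t - γ * s) first≡0 second≡0 ⟩
    α * + 0 - γ * + 0                                 ≡⟨ vanish α γ ⟩
    + 0                                               ∎)
  where
  open ≡-Reasoning
  unit : ∀ x → + 1 * x ≡ x
  unit = solve-∀
  solve-z : ∀ α β γ δ z w → (α * δ - β * γ) * z ≡ δ * (α * z + β * w) - β * (γ * z + δ * w)
  solve-z = solve-∀
  solve-w : ∀ α β γ δ z w → (α * δ - β * γ) * w ≡ α * (γ * z + δ * w) - γ * (α * z + β * w)
  solve-w = solve-∀
  vanish : ∀ s t → s * + 0 - t * + 0 ≡ + 0
  vanish = solve-∀

represents-act : ∀ f M {m} → det M ≡ + 1 → Represents (act f M) m → Represents f m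
represents-act f M det≡1 (z , w , zw≢0 , fMzw≡m) =
  p M * z + q M * w , u M * z + v M * w ,
  (λ Mzw≡0 → zw≢0 (unimodular-kernel M det≡1 (cong proj₁ Mzw≡0) (cong proj₂ Mzw≡0))) ,
  trans (sym (eval-act f M z w)) fMzw≡m

equivalent⇒disc≡ : ∀ f {h} → Equivalent f h → disc h ≡ disc f
equivalent⇒disc≡ f (M , det≡1 , refl) =
  trans (disc-act f M) (trans (cong (λ d → disc f * (d * d)) det≡1) (ℤₚ.*-identityʳ (disc f)))

equivalent⇒represents-a : ∀ f {h} → Equivalent f h → Represents h (a f)
equivalent⇒represents-a f (M , det≡1 , refl) =
  v M , - u M , adjugate-column-nonzero M (λ det≡0 → 1≢0 (trans (sym det≡1) det≡0)) ,
  trans (eval-adjugate-column f M) (trans (cong (λ d → a f * (d * d)) det≡1) (ℤₚ.*-identityʳ (a f)))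
  where
  1≢0 : + 1 ≢ + 0
  1≢0 ()

derived⇒represents : ∀ {d} n f → .{{ℕ.NonZero d}} → DerivedFrom d (e n) f → Represents f (+ (d ℕ.* d))
derived⇒represents {d} n f (_ , _ , A , det≡d , M , det≡1 , fM≡eA) =
  represents-act f M det≡1 (subst (λ g → Represents g (+ (d ℕ.* d))) (sym fM≡eA) eA-represents)
  where
  eA-represents : Represents (act (e n) A) (+ (d ℕ.* d))
  eA-represents =
    v A , - u A , adjugate-column-nonzero A (λ det≡0 → ℕ.≢-nonZero⁻¹ d (ℤₚ.+-injective (trans (sym det≡d) det≡0))) ,
    trans (eval-adjugate-column (e n) A)
      (trans (cong (λ r → + 1 * (r * r)) det≡d) (trans (ℤₚ.*-identityˡ _) (sym (ℤₚ.pos-* d d))))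

equivalent-principal⇒derived : ∀ f {P n} → Primitive f → (∃ λ Q → Equivalent f (principal P Q (+ n))) →
  DerivedFrom P (e n) f
equivalent-principal⇒derived f {P} {n} primitive-f (Q , f~h) =
  primitive-f , disc≡ , mat (+ P) Q (+ 0) (+ 1) , det≡P ,
  subst (Equivalent f) (sym (act-e-upper-triangular P Q n)) f~h
  where
  det≡P : + P * + 1 - Q * + 0 ≡ + P
  det≡P = identity (+ P) Q
    where
    identity : ∀ P Q → P * + 1 - Q * + 0 ≡ P
    identity = solve-∀
  disc≡ : disc f ≡ disc (e n) * (+ P * + P)
  disc≡ = trans (sym (equivalent⇒disc≡ f f~h)) (trans (disc-principal P Q (+ n))
                (trans (cong (λ X → - (+ 4 * X * + n)) (ℤₚ.pos-* P P)) (identity (+ P) (+ n))))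
    where
    identity : ∀ P n → - (+ 4 * (P * P) * n) ≡ (+ 0 * + 0 - + 4 * + 1 * n) * (P * P)
    identity = solve-∀

reduced⇒0≤a : ∀ f → Reduced f → + 0 ≤ a f
reduced⇒0≤a _ (∣b∣≤a , _) = ℤₚ.≤-trans (+≤+ z≤n) ∣b∣≤a

reduced⇒0≤c : ∀ f → Reduced f → + 0 ≤ c f
reduced⇒0≤c f reduced@(_ , a≤c , _) = ℤₚ.≤-trans (reduced⇒0≤a f reduced) a≤c

reduced⇒a≤eval : ∀ f {x y} → Reduced f → (x , y) ≢ (+ 0 , + 0) → a f ≤ eval f x y
-- Matching on the two +≤+ proofs exposes a f = + A and c f = + C.
reduced⇒a≤eval (form _ B _) {x} {y} (+≤+ {n = A} ∣B∣≤A , +≤+ {n = C} A≤C , _) xy≢0 = begin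
  + A                                   ≡⟨ shift (+ A) (+ T) ⟩
  + A + + T - + T                       ≡⟨ cong (_- + T) (ℤₚ.pos-+ A T) ⟨
  + (A ℕ.+ T) - + T                     ≤⟨ ℤₚ.+-monoˡ-≤ (- + T) (+≤+ (cross-term-dominated ∣B∣≤A A≤C αβ≢0)) ⟩
  + (Aαα ℕ.+ Cββ) - + T                 ≡⟨ cong (_- + T) (ℤₚ.pos-+ Aαα Cββ) ⟩
  + Aαα + + Cββ - + T                   ≤⟨ ℤₚ.+-monoʳ-≤ (+ Aαα + + Cββ) (proj₁ (∣i∣≤n⇒-n≤i≤n {B * x * y} (ℕₚ.≤-reflexive ∣Bxy∣≡T))) ⟩
  + Aαα + + Cββ + B * x * y             ≡⟨ reorder (+ Aαα) (+ Cββ) (B * x * y) ⟩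
  + Aαα + B * x * y + + Cββ             ≡⟨ cong₂ (λ s t → s + B * x * y + t) (diagonal A x) (diagonal C y) ⟨
  eval (form (+ A) B (+ C)) x y         ∎
  where
  open ℤₚ.≤-Reasoning
  α = ∣ x ∣
  β = ∣ y ∣
  Aαα = A ℕ.* (α ℕ.* α)
  Cββ = C ℕ.* (β ℕ.* β)
  T = ∣ B ∣ ℕ.* (α ℕ.* β)
  αβ≢0 : (α , β) ≢ (0 , 0)
  αβ≢0 αβ≡0 = xy≢0 (cong₂ _,_ (ℤₚ.∣i∣≡0⇒i≡0 (cong proj₁ αβ≡0)) (ℤₚ.∣i∣≡0⇒i≡0 (cong proj₂ αβ≡0)))
  ∣Bxy∣≡T : ∣ B * x * y ∣ ≡ T
  ∣Bxy∣≡T = trans (ℤₚ.abs-* (B * x) y) (trans (cong (ℕ._* β) (ℤₚ.abs-* B x)) (ℕₚ.*-assoc ∣ B ∣ α β))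
  diagonal : ∀ K z → + K * z * z ≡ + (K ℕ.* (∣ z ∣ ℕ.* ∣ z ∣))
  diagonal K z = trans (ℤₚ.*-assoc (+ K) z z) (trans (cong (+ K *_) (i*i≡∣i∣*∣i∣ z)) (sym (ℤₚ.pos-* K _)))
  shift : ∀ s t → s ≡ s + t - t
  shift = solve-∀
  reorder : ∀ r s t → r + s + t ≡ r + t + s
  reorder = solve-∀

principal-min : ∀ P Q {N} → P ℕ.* P ℕ.≤ N → ∀ {z w} → (z , w) ≢ (+ 0 , + 0) →
  + (P ℕ.* P) ≤ eval (principal P Q (+ N)) z w
principal-min P Q {N} P²≤N {z} {w} zw≢0 with w ℤ.≟ + 0
... | yes refl = begin
  + (P ℕ.* P)                       ≤⟨ +≤+ (ℕₚ.m≤m*n (P ℕ.* P) (ζ ℕ.* ζ)) ⟩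
  + (P ℕ.* P ℕ.* (ζ ℕ.* ζ))         ≡⟨ ℤₚ.pos-* (P ℕ.* P) (ζ ℕ.* ζ) ⟩
  + (P ℕ.* P) * + (ζ ℕ.* ζ)         ≡⟨ cong (+ (P ℕ.* P) *_) (i*i≡∣i∣*∣i∣ z) ⟨
  + (P ℕ.* P) * (z * z)             ≡⟨ eval-on-axis (principal P Q (+ N)) z ⟨
  eval (principal P Q (+ N)) z (+ 0) ∎
  where
  open ℤₚ.≤-Reasoning
  ζ = ∣ z ∣
  instance
    ζ≢0 : ℕ.NonZero ζ
    ζ≢0 = ℕ.≢-nonZero (λ ζ≡0 → zw≢0 (cong (_, + 0) (ℤₚ.∣i∣≡0⇒i≡0 ζ≡0)))
    ζζ≢0 : ℕ.NonZero (ζ ℕ.* ζ)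
    ζζ≢0 = ℕₚ.m*n≢0 ζ ζ
... | no w≢0 = begin
  + (P ℕ.* P)                       ≤⟨ +≤+ (ℕₚ.≤-trans P²≤N (ℕₚ.≤-trans (ℕₚ.m≤m*n N (ω ℕ.* ω)) (ℕₚ.m≤n+m _ (σ ℕ.* σ)))) ⟩
  + (σ ℕ.* σ ℕ.+ N ℕ.* (ω ℕ.* ω))   ≡⟨ ℤₚ.pos-+ (σ ℕ.* σ) (N ℕ.* (ω ℕ.* ω)) ⟩
  + (σ ℕ.* σ) + + (N ℕ.* (ω ℕ.* ω)) ≡⟨ cong (λ t → + (σ ℕ.* σ) + t) (ℤₚ.pos-* N (ω ℕ.* ω)) ⟩
  + (σ ℕ.* σ) + + N * + (ω ℕ.* ω)   ≡⟨ cong₂ (λ s t → s + + N * t) (i*i≡∣i∣*∣i∣ S) (i*i≡∣i∣*∣i∣ w) ⟨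
  S * S + + N * (w * w)             ≡⟨ eval-principal P Q (+ N) z w ⟨
  eval (principal P Q (+ N)) z w    ∎
  where
  open ℤₚ.≤-Reasoning
  S = + P * z + Q * w
  σ = ∣ S ∣
  ω = ∣ w ∣
  instance
    ω≢0 : ℕ.NonZero ω
    ω≢0 = ℕ.≢-nonZero (λ ω≡0 → w≢0 (ℤₚ.∣i∣≡0⇒i≡0 ω≡0))
    ωω≢0 : ℕ.NonZero (ω ℕ.* ω)
    ωω≢0 = ℕₚ.m*n≢0 ω ω

a≡square⇒principal : ∀ f {P N} .{{_ : ℕ.NonZero P}} → a f ≡ + (P ℕ.* P) →
  disc f ≡ - (+ 4 * + (P ℕ.* P) * N) → ∃ λ Q → f ≡ principal P Q N
a≡square⇒principal (form _ B C) {P@(suc _)} {N} refl disc≡ =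
  Q , cong₂ (form (+ (P ℕ.* P))) (trans B≡Q*2P (ℤₚ.*-comm Q 2P)) C≡Q*Q+N
  where
  open ≡-Reasoning
  2P = + 2 * + P
  B*B≡ : B * B ≡ (C - N) * (2P * 2P)
  B*B≡ = begin
    B * B                                                   ≡⟨ complete B (+ (P ℕ.* P)) C ⟩
    B * B - + 4 * + (P ℕ.* P) * C + + 4 * + (P ℕ.* P) * C   ≡⟨ cong (_+ + 4 * + (P ℕ.* P) * C) disc≡ ⟩
    - (+ 4 * + (P ℕ.* P) * N) + + 4 * + (P ℕ.* P) * C       ≡⟨ cong (λ t → - (+ 4 * t * N) + + 4 * t * C) (ℤₚ.pos-* P P) ⟩
    - (+ 4 * (+ P * + P) * N) + + 4 * (+ P * + P) * C       ≡⟨ regroup (+ P) C N ⟩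
    (C - N) * (2P * 2P)                                     ∎
    where
    complete : ∀ B X C → B * B ≡ B * B - + 4 * X * C + + 4 * X * C
    complete = solve-∀
    regroup : ∀ P C N → - (+ 4 * (P * P) * N) + + 4 * (P * P) * C ≡ (C - N) * ((+ 2 * P) * (+ 2 * P))
    regroup = solve-∀
  2P∣B : 2P ℤ∣.∣ B
  2P∣B = i*i∣j*j⇒i∣j 2P B (ℤ∣.divides (C - N) B*B≡)
  Q = ℤ∣._∣_.quotient 2P∣B
  B≡Q*2P : B ≡ Q * 2P
  B≡Q*2P = ℤ∣._∣_.equality 2P∣B
  Q*Q≡C-N : Q * Q ≡ C - N
  Q*Q≡C-N = ℤₚ.*-cancelʳ-≡ (Q * Q) (C - N) (2P * 2P) (begin
    (Q * Q) * (2P * 2P)     ≡⟨ interchange Q 2P ⟩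
    (Q * 2P) * (Q * 2P)     ≡⟨ cong (λ t → t * t) B≡Q*2P ⟨
    B * B                   ≡⟨ B*B≡ ⟩
    (C - N) * (2P * 2P)     ∎)
    where
    interchange : ∀ x y → (x * x) * (y * y) ≡ (x * y) * (x * y)
    interchange = solve-∀
  C≡Q*Q+N : C ≡ Q * Q + N
  C≡Q*Q+N = trans (restore C N) (cong (_+ N) (sym Q*Q≡C-N))
    where
    restore : ∀ C N → C ≡ C - N + N
    restore = solve-∀

reduced-equivalent-principal⇒principal : ∀ f {P N} .{{_ : ℕ.NonZero P}} → Reduced f →
  Represents f (+ (P ℕ.* P)) → (∃ λ Q → Equivalent f (principal P Q (+ N))) → P ℕ.* P ℕ.≤ N →
  ∃ λ k → f ≡ principal P k (+ N) × - (+ P) ≤ + 2 * k × + 2 * k ≤ + P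
reduced-equivalent-principal⇒principal f {P} {N} reduced (x , y , xy≢0 , fxy≡P²) (Q , f~h) P²≤N =
  k , f≡principal , ∣i∣≤n⇒-n≤i≤n ∣2k∣≤P
  where
  a≤P² : a f ≤ + (P ℕ.* P)
  a≤P² = subst (a f ≤_) fxy≡P² (reduced⇒a≤eval f reduced xy≢0)
  P²≤a : + (P ℕ.* P) ≤ a f
  P²≤a with equivalent⇒represents-a f f~h
  ... | z , w , zw≢0 , hzw≡a = subst (+ (P ℕ.* P) ≤_) hzw≡a (principal-min P Q P²≤N zw≢0)
  f-principal : ∃ λ k → f ≡ principal P k (+ N)
  f-principal = a≡square⇒principal f (ℤₚ.≤-antisym a≤P² P²≤a)
                  (trans (sym (equivalent⇒disc≡ f f~h)) (disc-principal P Q (+ N)))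
  k = proj₁ f-principal
  f≡principal = proj₂ f-principal
  P*∣2k∣≤P*P : P ℕ.* ∣ + 2 * k ∣ ℕ.≤ P ℕ.* P
  P*∣2k∣≤P*P = subst (ℕ._≤ P ℕ.* P)
    (trans (cong ∣_∣ (regroup (+ P) k)) (ℤₚ.abs-* (+ P) (+ 2 * k)))
    (ℤₚ.drop‿+≤+ (proj₁ (subst Reduced f≡principal reduced)))
    where
    regroup : ∀ P k → + 2 * P * k ≡ P * (+ 2 * k)
    regroup = solve-∀
  ∣2k∣≤P : ∣ + 2 * k ∣ ℕ.≤ P
  ∣2k∣≤P = ℕₚ.*-cancelˡ-≤ P P*∣2k∣≤P*P

represented-y-bound : ∀ f {A D x y m} .{{_ : ℕ.NonZero D}} → a f ≡ + A → disc f ≡ - (+ D) →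
  eval f x y ≡ + m → ∣ y ∣ ℕ.≤ 4 ℕ.* A ℕ.* m
represented-y-bound f {A} {D} {x} {y} {m} a≡A disc≡ fxy≡m =
  sum-of-squares-bound (+ 2 * a f * x + b f * y) y (begin
    + (4 ℕ.* A ℕ.* m)                                          ≡⟨ cast ⟩
    + 4 * a f * eval f x y                                     ≡⟨ complete-square (a f) (b f) (c f) x y ⟩
    (+ 2 * a f * x + b f * y) * (+ 2 * a f * x + b f * y) - disc f * (y * y)
                                                               ≡⟨ cong (λ d → Z * Z - d * (y * y)) disc≡ ⟩
    (+ 2 * a f * x + b f * y) * (+ 2 * a f * x + b f * y) - - (+ D) * (y * y)
                                                               ≡⟨ double-negation (Z * Z) (+ D) (y * y) ⟩
    (+ 2 * a f * x + b f * y) * (+ 2 * a f * x + b f * y) + + D * (y * y) ∎)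
  where
  open ≡-Reasoning
  Z = + 2 * a f * x + b f * y
  cast : + (4 ℕ.* A ℕ.* m) ≡ + 4 * a f * eval f x y
  cast = trans (ℤₚ.pos-* (4 ℕ.* A) m) (cong₂ _*_ (trans (ℤₚ.pos-* 4 A) (cong (+ 4 *_) (sym a≡A))) (sym fxy≡m))
  complete-square : ∀ A B C x y → + 4 * A * (A * x * x + B * x * y + C * y * y)
                                ≡ (+ 2 * A * x + B * y) * (+ 2 * A * x + B * y) - (B * B - + 4 * A * C) * (y * y)
  complete-square = solve-∀
  double-negation : ∀ s d t → s - - d * t ≡ s + d * t
  double-negation = solve-∀

represents? : ∀ f {D} .{{_ : ℕ.NonZero D}} → disc f ≡ - (+ D) → + 0 ≤ a f → + 0 ≤ c f →
  ∀ m → Dec (Represents f (+ m))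
represents? f {D} disc≡ 0≤a 0≤c m =
  map′ forget-bounds add-bounds
    (any-∣∣<? (λ x → any-∣∣<? (λ y → ¬? (Σₚ.≡-dec ℤ._≟_ ℤ._≟_ (x , y) (+ 0 , + 0)) ×-dec (eval f x y ℤ.≟ + m)) K) K)
  where
  A = ∣ a f ∣
  C = ∣ c f ∣
  K = suc (4 ℕ.* (A ℕ.+ C) ℕ.* m)
  enlarge : ∀ {i} E → i ℕ.≤ 4 ℕ.* E ℕ.* m → E ℕ.≤ A ℕ.+ C → i ℕ.< K
  enlarge E i≤ E≤ = s≤s (ℕₚ.≤-trans i≤ (ℕₚ.*-monoˡ-≤ m (ℕₚ.*-monoʳ-≤ 4 E≤)))
  add-bounds : Represents f (+ m) → ∃ λ x → ∣ x ∣ ℕ.< K × ∃ λ y → ∣ y ∣ ℕ.< K × (x , y) ≢ (+ 0 , + 0) × eval f x y ≡ + m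
  add-bounds (x , y , xy≢0 , fxy≡m) =
    x , enlarge C (represented-y-bound (swap f) (sym (ℤₚ.0≤i⇒+∣i∣≡i 0≤c)) (trans (disc-swap f) disc≡)
                    (trans (eval-swap f x y) fxy≡m)) (ℕₚ.m≤n+m C A) ,
    y , enlarge A (represented-y-bound f (sym (ℤₚ.0≤i⇒+∣i∣≡i 0≤a)) disc≡ fxy≡m) (ℕₚ.m≤m+n A C) ,
    xy≢0 , fxy≡m
  forget-bounds : (∃ λ x → ∣ x ∣ ℕ.< K × ∃ λ y → ∣ y ∣ ℕ.< K × (x , y) ≢ (+ 0 , + 0) × eval f x y ≡ + m) → Represents f (+ m)
  forget-bounds (x , _ , y , _ , xy≢0 , fxy≡m) = x , y , xy≢0 , fxy≡m

least-represented-square-divisor : ∀ f {A n} .{{_ : ℕ.NonZero A}} .{{_ : ℕ.NonZero n}} →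
  disc f ≡ - (+ (4 ℕ.* A ℕ.* A ℕ.* n)) → Reduced f → Represents f (+ (A ℕ.* A)) →
  ∃ λ P → (P ℕ∣.∣ A × Represents f (+ (P ℕ.* P))) × (∀ {d} → d ℕ.< P → ¬ (d ℕ∣.∣ A × Represents f (+ (d ℕ.* d))))
least-represented-square-divisor f {A} {n} disc≡ reduced A²-represented =
  least (λ d → (d ℕ∣.∣? A) ×-dec represents? f disc≡ (reduced⇒0≤a f reduced) (reduced⇒0≤c f reduced) (d ℕ.* d))
        (ℕ∣.∣-refl , A²-represented)
  where
  instance
    4AAn≢0 : ℕ.NonZero (4 ℕ.* A ℕ.* A ℕ.* n)
    4AAn≢0 = ℕₚ.m*n≢0 (4 ℕ.* A ℕ.* A) n {{ℕₚ.m*n≢0 (4 ℕ.* A) A {{ℕₚ.m*n≢0 4 A}}}}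

least-divisor-maximizes-cofactor : ∀ f {A n P M} .{{_ : ℕ.NonZero A}} .{{_ : ℕ.NonZero P}} → P ℕ.* M ≡ A →
  (∀ {d} → d ℕ.< P → ¬ (d ℕ∣.∣ A × Represents f (+ (d ℕ.* d)))) →
  ∀ d m′ → d ℕ.* m′ ≡ A → DerivedFrom d (e (m′ ℕ.* m′ ℕ.* n)) f → m′ ℕ.* m′ ℕ.* n ℕ.≤ M ℕ.* M ℕ.* n
least-divisor-maximizes-cofactor f {A} {n} {P} {M} P*M≡A below d m′ d*m′≡A derived =
  ℕₚ.*-monoˡ-≤ n (ℕₚ.*-mono-≤ m′≤M m′≤M)
  where
  d∣A : d ℕ∣.∣ A
  d∣A = divides m′ (trans (sym d*m′≡A) (ℕₚ.*-comm d m′))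
  instance
    d≢0 : ℕ.NonZero d
    d≢0 = divisor-nonZero d∣A
  P≤d : P ℕ.≤ d
  P≤d = ℕₚ.≮⇒≥ (λ d<P → below d<P (d∣A , derived⇒represents (m′ ℕ.* m′ ℕ.* n) f derived))
  m′≤M : m′ ℕ.≤ M
  m′≤M = ℕₚ.*-cancelˡ-≤ P (ℕₚ.≤-trans (ℕₚ.*-monoˡ-≤ m′ P≤d) (ℕₚ.≤-reflexive (trans d*m′≡A (sym P*M≡A))))

cancel-common-factor : ∀ f {x y g P} .{{_ : ℕ.NonZero g}} →
  eval f (x * + g) (y * + g) ≡ + (P ℕ.* P) → ∃ λ P′ → P ≡ P′ ℕ.* g × eval f x y ≡ + (P′ ℕ.* P′)
cancel-common-factor f {x} {y} {g} {P} fgxgy≡P² = P′ , P≡P′g , fxy≡P′²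
  where
  E = eval f x y
  instance
    gg≢0 : ℕ.NonZero (g ℕ.* g)
    gg≢0 = ℕₚ.m*n≢0 g g
  gg*E≡P² : + (g ℕ.* g) * E ≡ + (P ℕ.* P)
  gg*E≡P² = trans (cong (_* E) (ℤₚ.pos-* g g)) (trans (sym (eval-scale f x y (+ g))) fgxgy≡P²)
  gg∣PP : g ℕ.* g ℕ∣.∣ P ℕ.* P
  gg∣PP = divides ∣ E ∣ (trans (cong ∣_∣ (sym gg*E≡P²)) (trans (ℤₚ.abs-* (+ (g ℕ.* g)) E) (ℕₚ.*-comm (g ℕ.* g) ∣ E ∣)))
  g∣P = m*m∣n*n⇒m∣n g P gg∣PP
  P′ = ℕ∣._∣_.quotient g∣P
  P≡P′g : P ≡ P′ ℕ.* g
  P≡P′g = ℕ∣._∣_.equality g∣P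
  square-of-product : ∀ x y → (x ℕ.* y) ℕ.* (x ℕ.* y) ≡ (y ℕ.* y) ℕ.* (x ℕ.* x)
  square-of-product = ℕRing.solve-∀
  fxy≡P′² : E ≡ + (P′ ℕ.* P′)
  fxy≡P′² = ℤₚ.*-cancelˡ-≡ (+ (g ℕ.* g)) E (+ (P′ ℕ.* P′))
    (trans gg*E≡P² (trans (cong (λ t → + (t ℕ.* t)) P≡P′g)
      (trans (cong +_ (square-of-product P′ g)) (ℤₚ.pos-* (g ℕ.* g) (P′ ℕ.* P′)))))

least-square⇒properly-represented : ∀ f {A P} .{{_ : ℕ.NonZero A}} → P ℕ∣.∣ A →
  (∀ {d} → d ℕ.< P → ¬ (d ℕ∣.∣ A × Represents f (+ (d ℕ.* d)))) →
  Represents f (+ (P ℕ.* P)) → ProperlyRepresents f (+ (P ℕ.* P))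
least-square⇒properly-represented f {A} {P} P∣A below (x , y , xy≢0 , fxy≡P²) =
  x , y , (λ {g} (g∣x , g∣y) → common-divisor-is-1 g g∣x g∣y) , fxy≡P²
  where
  common-divisor-is-1 : ∀ g → g ℕ∣.∣ ∣ x ∣ → g ℕ∣.∣ ∣ y ∣ → g ≡ 1
  common-divisor-is-1 zero 0∣x 0∣y =
    ⊥-elim (xy≢0 (cong₂ _,_ (ℤₚ.∣i∣≡0⇒i≡0 (ℕ∣.0∣⇒≡0 0∣x)) (ℤₚ.∣i∣≡0⇒i≡0 (ℕ∣.0∣⇒≡0 0∣y))))
  common-divisor-is-1 (suc zero) _ _ = refl
  -- Dividing (x, y) by g represents (P/g)², and P/g is a smaller divisor of A.
  common-divisor-is-1 g@(suc (suc _)) g∣x g∣y = ⊥-elim (below P′<P (P′∣A , x′ , y′ , x′y′≢0 , fx′y′≡P′²))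
    where
    x′ = ℤ∣._∣_.quotient (∣ᵤ⇒∣ {+ g} {x} g∣x)
    y′ = ℤ∣._∣_.quotient (∣ᵤ⇒∣ {+ g} {y} g∣y)
    x≡x′g : x ≡ x′ * + g
    x≡x′g = ℤ∣._∣_.equality (∣ᵤ⇒∣ {+ g} {x} g∣x)
    y≡y′g : y ≡ y′ * + g
    y≡y′g = ℤ∣._∣_.equality (∣ᵤ⇒∣ {+ g} {y} g∣y)
    reduced-representation = cancel-common-factor f {x′} {y′} {g} {P} (trans (cong₂ (eval f) (sym x≡x′g) (sym y≡y′g)) fxy≡P²)
    P′ = proj₁ reduced-representation
    P≡P′g = proj₁ (proj₂ reduced-representation)
    fx′y′≡P′² = proj₂ (proj₂ reduced-representation)
    x′y′≢0 : (x′ , y′) ≢ (+ 0 , + 0)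
    x′y′≢0 x′y′≡0 = xy≢0 (cong₂ _,_ (trans x≡x′g (cong (_* + g) (cong proj₁ x′y′≡0)))
                                    (trans y≡y′g (cong (_* + g) (cong proj₂ x′y′≡0))))
    P′∣A : P′ ℕ∣.∣ A
    P′∣A = ℕ∣.∣-trans (divides g (trans P≡P′g (ℕₚ.*-comm P′ g))) P∣A
    instance
      P′≢0 : ℕ.NonZero P′
      P′≢0 = divisor-nonZero P′∣A
    P′<P : P′ ℕ.< P
    P′<P = subst (P′ ℕ.<_) (sym P≡P′g) (ℕₚ.m<m*n P′ g (s≤s (s≤s z≤n)))

properly-represents-square⇒principal : ∀ f {P N} .{{_ : ℕ.NonZero P}} →
  disc f ≡ - (+ 4 * + (P ℕ.* P) * N) → ProperlyRepresents f (+ (P ℕ.* P)) →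
  ∃ λ Q → Equivalent f (principal P Q N)
properly-represents-square⇒principal f {P} {N} disc≡ (x , y , coprime , fxy≡P²)
  with coprime⇒bezout x y coprime
... | r , s , bezout = proj₁ h-principal , M , det≡1 , proj₂ h-principal
  where
  -- Since the first column of M is (x, y), fxy≡P² already states a (act f M) ≡ P².
  M = mat x (- s) y r
  det≡1 : det M ≡ + 1
  det≡1 = trans (expand x y r s) bezout
    where
    expand : ∀ x y r s → x * r - (- s) * y ≡ r * x + s * y
    expand = solve-∀
  h-principal : ∃ λ Q → act f M ≡ principal P Q N
  h-principal = a≡square⇒principal (act f M) fxy≡P² (trans (equivalent⇒disc≡ f (M , det≡1 , refl)) disc≡)

discriminant-factor : ∀ P M n →
  - (+ (4 ℕ.* (P ℕ.* M) ℕ.* (P ℕ.* M) ℕ.* n)) ≡ - (+ 4 * + (P ℕ.* P) * + (M ℕ.* M ℕ.* n))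
discriminant-factor P M n = cong -_ (trans (cong +_ (regroup P M n))
  (trans (ℤₚ.pos-* (4 ℕ.* (P ℕ.* P)) (M ℕ.* M ℕ.* n)) (cong (_* + (M ℕ.* M ℕ.* n)) (ℤₚ.pos-* 4 (P ℕ.* P)))))
  where
  regroup : ∀ P M n → 4 ℕ.* (P ℕ.* M) ℕ.* (P ℕ.* M) ℕ.* n ≡ 4 ℕ.* (P ℕ.* P) ℕ.* (M ℕ.* M ℕ.* n)
  regroup = ℕRing.solve-∀

propositionA2 : ∀ (a b : ℕ) → 0 ℕ.< a → 0 ℕ.< b → SquareFree b →
    ∀ (f : Form) → Reduced f → Primitive f →
    disc f ≡ - (+ (4 ℕ.* a ℕ.* a ℕ.* b)) →
    DerivedFrom a (e b) f →
    ¬ Equivalent f (e (a ℕ.* a ℕ.* b)) →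
    ∃ λ (a₂ : ℕ) → ∃ λ (m : ℕ) → a₂ ℕ.* m ≡ a
      × DerivedFrom a₂ (e (m ℕ.* m ℕ.* b)) f
      × (∀ (d m′ : ℕ) → d ℕ.* m′ ≡ a → DerivedFrom d (e (m′ ℕ.* m′ ℕ.* b)) f →
           m′ ℕ.* m′ ℕ.* b ℕ.≤ m ℕ.* m ℕ.* b)
      × (a₂ ℕ.* a₂ ℕ.< m ℕ.* m ℕ.* b →
           ∃ λ (k : ℤ) → f ≡ form (+ (a₂ ℕ.* a₂)) (+ 2 * + a₂ * k) (k * k + + (m ℕ.* m ℕ.* b))
             × - (+ a₂) ≤ + 2 * k × + 2 * k ≤ + a₂)
propositionA2 a b 0<a 0<b _ f reduced primitive-f disc≡ derived _ =
  P , M , P*M≡a , equivalent-principal⇒derived f primitive-f f~h ,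
  least-divisor-maximizes-cofactor f P*M≡a below-P ,
  λ P²<N → reduced-equivalent-principal⇒principal f reduced P²-represented f~h (ℕₚ.<⇒≤ P²<N)
  where
  instance
    a≢0 : ℕ.NonZero a
    a≢0 = ℕ.>-nonZero 0<a
    b≢0 : ℕ.NonZero b
    b≢0 = ℕ.>-nonZero 0<b
  least-P = least-represented-square-divisor f {a} disc≡ reduced (derived⇒represents b f derived)
  P = proj₁ least-P
  P∣a = proj₁ (proj₁ (proj₂ least-P))
  P²-represented = proj₂ (proj₁ (proj₂ least-P))
  below-P = proj₂ (proj₂ least-P)
  M = ℕ∣._∣_.quotient P∣a
  instance
    P≢0 : ℕ.NonZero P
    P≢0 = divisor-nonZero P∣a
  P*M≡a : P ℕ.* M ≡ a
  P*M≡a = sym (trans (ℕ∣._∣_.equality P∣a) (ℕₚ.*-comm M P))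
  f~h : ∃ λ Q → Equivalent f (principal P Q (+ (M ℕ.* M ℕ.* b)))
  f~h = properly-represents-square⇒principal f
          (trans (subst (λ t → disc f ≡ - (+ (4 ℕ.* t ℕ.* t ℕ.* b))) (sym P*M≡a) disc≡) (discriminant-factor P M b))
          (least-square⇒properly-represented f P∣a below-P P²-represented)
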